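{- Let $D=(E,\Phi)$ be a binary delta-matroid and let $a,b\in E$ with $a\neq b$. Then $$q_{\Delta}(D,x)-q_{\Delta}(D'_{ab},x)=q_{\Delta}(\widetilde{D}_{ab},x)-q_{\Delta}(\widetilde{D'_{ab}},x),$$ where $D'_{ab}$ is the result of exchanging the ends of the handles $a$ and $b$ in $D$, $\widetilde{D}_{ab}$ is the result of the handle slide taking $a$ over $b$ in $D$, and $\widetilde{D'_{ab}}$ is the result of the handle slide taking $a$ over $b$ applied to $D'_{ab}$.
   Context: A set system is a pair $(E,\Phi)$ with $E$ a finite set and $\Phi\subseteq 2^E$ nonempty; elements of $\Phi$ are feasible sets. A delta-matroid is a set system such that for all $X,Y\in\Phi$ and every $x\in X\Delta Y$ there is $y\in X\Delta Y$ with $\{x,y\}\Delta X\in\Phi$ ($\Delta$ = symmetric difference). For $X\subseteq E$, the twist is $D*X=(E,\{F\Delta X: F\in\Phi\})$. For a symmetric matrix $A$ over $\mathbb{F}_2$ with rows and columns indexed by $E$ (diagonal entries arbitrary), $M_A=(E,\Phi)$ where $X\in\Phi$ iff the principal submatrix $A[X]$ is nondegenerate (the empty matrix counts as nondegenerate). A delta-matroid is binary if it is a twist $M_A*X$ of some such $M_A$. For a set system $D=(E,\Phi)$ and distinct $a,b\in E$: the handle slide taking $a$ over $b$ is $\widetilde{D}_{ab}=(E,\Phi\Delta\{X\sqcup\{a\}: X\sqcup\{b\}\in\Phi,\ X\subseteq E\setminus\{a,b\}\})$; exchanging the ends of handles $a$ and $b$ gives $D'_{ab}=(E,\Phi\Delta\{X\sqcup\{a,b\}: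 X\in\Phi,\ X\subseteq E\setminus\{a,b\}\})$ (both operations preserve binary delta-matroids). The distance from $D$ to $X\subseteq E$ is $d_D(X)=\min_{F\in\Phi}|F\Delta X|$, and the interlace polynomial is $q_{\Delta}(D,x)=\sum_{\phi\subseteq E}x^{d_D(\phi)}$. -}

module Defs where

open import Data.Bool using (Bool; true; false; _∧_; _∨_; not; _xor_; if_then_else_)
open import Data.Nat using (ℕ; zero; suc; _≡ᵇ_; _⊓_)
open import Data.Fin using (Fin)
open import Data.Vec using (Vec; []; _∷_; lookup; zipWith; _[_]≔_)
open import Data.List using (List; []; _∷_; _++_; map; filter; length; foldr; allFin; all)
open import Data.Fin.Subset using (Subset; ∣_∣)
open import Data.Product using (Σ-syntax; _×_)
open import Data.Integer using (ℤ; +_)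
open import Relation.Binary.PropositionalEquality using (_≡_)
open import Relation.Nullary.Decidable using (T?)

-- Ground set E = Fin n; subsets of E are Data.Fin.Subset (Vec Bool n).
-- A set system on Fin n is given by the characteristic (Bool) function of its
-- family Φ of feasible sets.
SetSystem : ℕ → Set
SetSystem n = Subset n → Bool

allSubsets : (n : ℕ) → List (Subset n)
allSubsets zero    = [] ∷ []
allSubsets (suc n) = map (false ∷_) (allSubsets n) ++ map (true ∷_) (allSubsets n)

_Δ_ : ∀ {n} → Subset n → Subset n → Subset n
_Δ_ = zipWith _xor_

anyᵇ : ∀ {A : Set} → (A → Bool) → List A → Bool
anyᵇ p = foldr (λ x r → p x ∨ r) false

allᵇ : ∀ {A : Set} → (A → Bool) → List A → Bool
allᵇ p = foldr (λ x r → p x ∧ r) true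

xorSum : ∀ {A : Set} → (A → Bool) → List A → Bool
xorSum p = foldr (λ x r → p x xor r) false

isEmptyᵇ : ∀ {n} → Subset n → Bool
isEmptyᵇ v = not (anyᵇ (lookup v) (allFin _))

_⊆ᵇ_ : ∀ {n} → Subset n → Subset n → Bool
v ⊆ᵇ X = allᵇ (λ i → not (lookup v i) ∨ lookup X i) (allFin _)

-- Matrices over F₂ (Bool, with xor as + and ∧ as ·), rows/columns indexed by E.
Matrix₂ : ℕ → Set
Matrix₂ n = Fin n → Fin n → Bool

Symmetric : ∀ {n} → Matrix₂ n → Set
Symmetric A = ∀ i j → A i j ≡ A j i

-- The principal submatrix A[X] is nondegenerate: no nonzero vector v over F₂
-- supported on X lies in its kernel, i.e. A[X] v = 0 (for rows i ∈ X) forces v = 0.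
-- (Empty A[X] counts as nondegenerate, automatically.)
nondegᵇ : ∀ {n} → Matrix₂ n → Subset n → Bool
nondegᵇ {n} A X =
  allᵇ (λ v → not ( (v ⊆ᵇ X) ∧ not (isEmptyᵇ v)
                   ∧ allᵇ (λ i → not (lookup X i)
                                 ∨ not (xorSum (λ j → A i j ∧ lookup v j) (allFin n)))
                          (allFin n)))
       (allSubsets n)

M : ∀ {n} → Matrix₂ n → SetSystem n
M A = nondegᵇ A

twist : ∀ {n} → SetSystem n → Subset n → SetSystem n
twist Φ X Y = Φ (Y Δ X)

IsBinary : ∀ {n} → SetSystem n → Set
IsBinary {n} Φ =
  Σ[ A ∈ Matrix₂ n ] Σ[ X ∈ Subset n ] (Symmetric A × (∀ Y → Φ Y ≡ twist (M A) X Y))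

-- handle slide taking a over b:
-- Φ Δ { X ⊔ {a} : X ⊔ {b} ∈ Φ, X ⊆ E∖{a,b} }
handleSlide : ∀ {n} → SetSystem n → Fin n → Fin n → SetSystem n
handleSlide Φ a b Y =
  Φ Y xor (lookup Y a ∧ not (lookup Y b) ∧ Φ ((Y [ a ]≔ false) [ b ]≔ true))

-- exchanging the ends of handles a and b:
-- Φ Δ { X ⊔ {a,b} : X ∈ Φ, X ⊆ E∖{a,b} }
exchange : ∀ {n} → SetSystem n → Fin n → Fin n → SetSystem n
exchange Φ a b Y =
  Φ Y xor (lookup Y a ∧ lookup Y b ∧ Φ ((Y [ a ]≔ false) [ b ]≔ false))

minWith : ℕ → List ℕ → ℕ
minWith d []       = d
minWith d (x ∷ xs) = foldr _⊓_ x xs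

-- d_D(X) = min_{F ∈ Φ} |F Δ X|   (Φ is nonempty for every delta-matroid;
-- the default suc n is never used for the set systems in the theorem)
dist : ∀ {n} → SetSystem n → Subset n → ℕ
dist {n} Φ X = minWith (suc n) (map (λ F → ∣ F Δ X ∣) (filter (λ F → T? (Φ F)) (allSubsets n)))

-- coefficient of x^k in q_Δ(D,x) = Σ_{φ ⊆ E} x^{d_D(φ)}
qCoeff : ∀ {n} → SetSystem n → ℕ → ℤ
qCoeff {n} Φ k = + length (filter (λ φ → T? (dist Φ φ ≡ᵇ k)) (allSubsets n))

-- Both operations have the form Φ ↦ Φ Δ {Y : a ∈ Y, g Y, σ Y ∈ Φ} with a ∉ σ Y (σ Y = Y - a + b
-- for the handle slide, Y - a - b for the exchange), so for every F in the difference σ F is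
-- feasible both before and after. Fix X. Unless a ∈ X ∌ b, passing from F to F - a + b does not
-- increase |F Δ X|, so the handle slide preserves d(X), for D and for D'_ab. If a ∈ X ∌ b,
-- passing from F to F - a - b preserves |F Δ X|, so exchanging the ends preserves d(X), for D
-- and, since the two operations commute, for D̃_ab. Either way the four distances at X pair
-- off, and counting the X at distance k gives the identity.
module Submission where

open import Defs
open import Data.Bool using (Bool; true; false; _∧_; not; _xor_)
open import Data.Bool.Properties using (xor-assoc; xor-comm; xor-identityʳ; ∧-conicalˡ; ∧-conicalʳ; T-≡)
open import Data.Empty using (⊥-elim)
open import Data.Fin using (Fin; zero; suc)
open import Data.Fin.Subset using (Subset; ∣_∣)
open import Data.Fin.Subset.Properties using (∣p∣≤n)
open import Data.Integer using (+_; _-_; _⊖_)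
open import Data.Integer.Properties using ([+m]-[+n]≡m⊖n; +-cancelˡ-⊖)
open import Data.List using (List; []; _∷_; map; filter; length; foldr)
open import Data.List.Membership.Propositional using (_∈_)
open import Data.List.Membership.Propositional.Properties
  using (∈-map⁺; ∈-map⁻; ∈-filter⁺; ∈-filter⁻; ∈-++⁺ˡ; ∈-++⁺ʳ)
open import Data.List.Relation.Unary.Any using (here; there)
open import Data.Nat using (ℕ; suc; _+_; _≤_; _⊓_; _≡ᵇ_; z≤n)
open import Data.Nat.Properties
open import Algebra.Properties.CommutativeSemigroup +-commutativeSemigroup
  using (x∙yz≈xz∙y; xy∙z≈xz∙y; interchange)
open import Data.Product using (Σ-syntax; _×_; _,_; proj₂)
open import Data.Sum using (_⊎_; inj₁; inj₂)
open import Data.Vec using ([]; _∷_; lookup; _[_]≔_)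
open import Data.Vec.Properties using (lookup∘update; lookup∘update′)
open import Function using (_∘_; Equivalence)
open import Relation.Nullary.Decidable using (T?)
open import Relation.Binary.PropositionalEquality
open ≡-Reasoning

bit : Bool → ℕ
bit false = 0
bit true  = 1

≡true⇒≢≡false : ∀ {x y : Bool} → x ≡ true → y ≡ false → x ≢ y
≡true⇒≢≡false refl refl ()

≢xor⇒≡true : ∀ x y → x ≢ x xor y → y ≡ true
≢xor⇒≡true x false x≢x = ⊥-elim (x≢x (sym (xor-identityʳ x)))
≢xor⇒≡true x true  _   = refl

xor-swapʳ : ∀ x y z → (x xor y) xor z ≡ (x xor z) xor y
xor-swapʳ x y z = begin
  (x xor y) xor z ≡⟨ xor-assoc x y z ⟩
  x xor (y xor z) ≡⟨ cong (x xor_) (xor-comm y z) ⟩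
  x xor (z xor y) ≡⟨ xor-assoc x z y ⟨
  (x xor z) xor y ∎

∣x∷p∣+y≡∣y∷p∣+x : ∀ {n} x y (p : Subset n) → ∣ x ∷ p ∣ + bit y ≡ ∣ y ∷ p ∣ + bit x
∣x∷p∣+y≡∣y∷p∣+x false false p = refl
∣x∷p∣+y≡∣y∷p∣+x true  true  p = refl
∣x∷p∣+y≡∣y∷p∣+x true  false p = trans (+-identityʳ (suc ∣ p ∣)) (+-comm 1 ∣ p ∣)
∣x∷p∣+y≡∣y∷p∣+x false true  p = sym (∣x∷p∣+y≡∣y∷p∣+x true false p)

∣x∷-∣-cong : ∀ {n} x (p q : Subset n) {k l} → ∣ p ∣ + k ≡ ∣ q ∣ + l → ∣ x ∷ p ∣ + k ≡ ∣ x ∷ q ∣ + l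
∣x∷-∣-cong false p q eq = eq
∣x∷-∣-cong true  p q eq = cong suc eq

∣[i]≔v-Δ∣ : ∀ {n} (F X : Subset n) i v →
  ∣ (F [ i ]≔ v) Δ X ∣ + bit (lookup F i xor lookup X i) ≡ ∣ F Δ X ∣ + bit (v xor lookup X i)
∣[i]≔v-Δ∣ (f ∷ F) (x ∷ X) zero    v = ∣x∷p∣+y≡∣y∷p∣+x (v xor x) (f xor x) (F Δ X)
∣[i]≔v-Δ∣ (f ∷ F) (x ∷ X) (suc i) v = ∣x∷-∣-cong (f xor x) ((F [ i ]≔ v) Δ X) (F Δ X) (∣[i]≔v-Δ∣ F X i v)

foldr-⊓-≤ : ∀ x xs {y} → y ∈ x ∷ xs → foldr _⊓_ x xs ≤ y
foldr-⊓-≤ x []       (here refl)          = ≤-refl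
foldr-⊓-≤ x (z ∷ zs) (here refl)          = ≤-trans (m⊓n≤n z _) (foldr-⊓-≤ x zs (here refl))
foldr-⊓-≤ x (z ∷ zs) (there (here refl))  = m⊓n≤m z _
foldr-⊓-≤ x (z ∷ zs) (there (there y∈zs)) = ≤-trans (m⊓n≤n z _) (foldr-⊓-≤ x zs (there y∈zs))

foldr-⊓-glb : ∀ {v} x xs → (∀ {y} → y ∈ x ∷ xs → v ≤ y) → v ≤ foldr _⊓_ x xs
foldr-⊓-glb x []       lb = lb (here refl)
foldr-⊓-glb x (z ∷ zs) lb = ⊓-glb (lb (there (here refl))) (foldr-⊓-glb x zs lb′)
  where
  lb′ : ∀ {y} → y ∈ x ∷ zs → _
  lb′ (here y≡x)  = lb (here y≡x)
  lb′ (there y∈zs) = lb (there (there y∈zs))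

minWith-≤ : ∀ d xs {y} → y ∈ xs → minWith d xs ≤ y
minWith-≤ d (x ∷ xs) = foldr-⊓-≤ x xs

minWith-≤-default : ∀ d xs → (∀ {y} → y ∈ xs → y ≤ d) → minWith d xs ≤ d
minWith-≤-default d []       ub = ≤-refl
minWith-≤-default d (x ∷ xs) ub = ≤-trans (foldr-⊓-≤ x xs (here refl)) (ub (here refl))

minWith-glb : ∀ {v} d xs → v ≤ d → (∀ {y} → y ∈ xs → v ≤ y) → v ≤ minWith d xs
minWith-glb d []       v≤d lb = v≤d
minWith-glb d (x ∷ xs) v≤d lb = foldr-⊓-glb x xs lb

∈-allSubsets : ∀ {n} (F : Subset n) → F ∈ allSubsets n
∈-allSubsets []                = here refl
∈-allSubsets {suc n} (false ∷ F) = ∈-++⁺ˡ (∈-map⁺ (false ∷_) (∈-allSubsets F))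
∈-allSubsets {suc n} (true ∷ F)  =
  ∈-++⁺ʳ (map (false ∷_) (allSubsets n)) (∈-map⁺ (true ∷_) (∈-allSubsets F))

module _ {n} (Φ : SetSystem n) (X : Subset n) where

  private
    feasible : List (Subset n)
    feasible = filter (λ F → T? (Φ F)) (allSubsets n)

    ∈-feasible⁻ : ∀ {F} → F ∈ feasible → Φ F ≡ true
    ∈-feasible⁻ F∈ = Equivalence.to T-≡ (proj₂ (∈-filter⁻ (λ F → T? (Φ F)) {xs = allSubsets n} F∈))

    ∈-distances⁻ : ∀ {y} → y ∈ map (λ F → ∣ F Δ X ∣) feasible →
                   Σ[ F ∈ Subset n ] Φ F ≡ true × y ≡ ∣ F Δ X ∣
    ∈-distances⁻ y∈ with ∈-map⁻ (λ F → ∣ F Δ X ∣) y∈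
    ... | F , F∈ , y≡ = F , ∈-feasible⁻ F∈ , y≡

  dist-≤ : ∀ {F} → Φ F ≡ true → dist Φ X ≤ ∣ F Δ X ∣
  dist-≤ {F} ΦF = minWith-≤ (suc n) _ (∈-map⁺ (λ G → ∣ G Δ X ∣)
    (∈-filter⁺ (λ G → T? (Φ G)) (∈-allSubsets F) (Equivalence.from T-≡ ΦF)))

  dist-≤-1+n : dist Φ X ≤ suc n
  dist-≤-1+n = minWith-≤-default (suc n) _ bound
    where
    bound : ∀ {y} → y ∈ map (λ F → ∣ F Δ X ∣) feasible → y ≤ suc n
    bound y∈ with ∈-distances⁻ y∈
    ... | F , _ , refl = m≤n⇒m≤1+n (∣p∣≤n (F Δ X))

  dist-glb : ∀ {v} → v ≤ suc n → (∀ F → Φ F ≡ true → v ≤ ∣ F Δ X ∣) → v ≤ dist Φ X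
  dist-glb v≤ lb = minWith-glb (suc n) _ v≤ bound
    where
    bound : ∀ {y} → y ∈ map (λ F → ∣ F Δ X ∣) feasible → _
    bound y∈ with ∈-distances⁻ y∈
    ... | F , ΦF , refl = lb F ΦF

dist-≤-dist : ∀ {n} (Φ Ψ : SetSystem n) X →
  (∀ F → Φ F ≡ true → Ψ F ≡ false → Σ[ G ∈ Subset n ] Ψ G ≡ true × ∣ G Δ X ∣ ≤ ∣ F Δ X ∣) →
  dist Ψ X ≤ dist Φ X
dist-≤-dist Φ Ψ X replace = dist-glb Φ X (dist-≤-1+n Ψ X) bound
  where
  bound : ∀ F → Φ F ≡ true → dist Ψ X ≤ ∣ F Δ X ∣
  bound F ΦF with Ψ F in ΨF
  ... | true  = dist-≤ Ψ X ΨF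
  ... | false with replace F ΦF ΨF
  ...   | G , ΨG , G-closer = ≤-trans (dist-≤ Ψ X ΨG) G-closer

dist-cong : ∀ {n} {Φ Ψ : SetSystem n} → (∀ Y → Φ Y ≡ Ψ Y) → ∀ X → dist Φ X ≡ dist Ψ X
dist-cong {Φ = Φ} {Ψ} Φ≗Ψ X = ≤-antisym
  (dist-≤-dist Ψ Φ X (λ F ΨF ΦF → ⊥-elim (≡true⇒≢≡false ΨF ΦF (sym (Φ≗Ψ F)))))
  (dist-≤-dist Φ Ψ X (λ F ΦF ΨF → ⊥-elim (≡true⇒≢≡false ΦF ΨF (Φ≗Ψ F))))

-- handleSlide Φ a b and exchange Φ a b are definitionally perturb a g (move a b false v) Φ,
-- with v = true, g Y = b ∉ Y, resp. v = false, g Y = b ∈ Y.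
perturb : ∀ {n} → Fin n → (Subset n → Bool) → (Subset n → Subset n) → SetSystem n → SetSystem n
perturb a g σ Φ Y = Φ Y xor (lookup Y a ∧ g Y ∧ Φ (σ Y))

Clears : ∀ {n} → Fin n → (Subset n → Subset n) → Set
Clears a σ = ∀ Y → lookup (σ Y) a ≡ false

module _ {n} {a : Fin n} {g : Subset n → Bool} {σ : Subset n → Subset n} where

  perturb-∉ : ∀ Φ {Y} → lookup Y a ≡ false → perturb a g σ Φ Y ≡ Φ Y
  perturb-∉ Φ {Y} a∉Y rewrite a∉Y = xor-identityʳ (Φ Y)

  perturb-changed : ∀ Φ Y → Φ Y ≢ perturb a g σ Φ Y →
    lookup Y a ≡ true × g Y ≡ true × Φ (σ Y) ≡ true
  perturb-changed Φ Y changed =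
    ∧-conicalˡ (lookup Y a) _ guarded , ∧-conicalˡ (g Y) _ rest , ∧-conicalʳ (g Y) _ rest
    where
    guarded : lookup Y a ∧ g Y ∧ Φ (σ Y) ≡ true
    guarded = ≢xor⇒≡true (Φ Y) _ changed
    rest : g Y ∧ Φ (σ Y) ≡ true
    rest = ∧-conicalʳ (lookup Y a) _ guarded

  dist-perturb : Clears a σ → ∀ Φ X →
    (∀ F → lookup F a ≡ true → g F ≡ true → ∣ σ F Δ X ∣ ≤ ∣ F Δ X ∣) →
    dist Φ X ≡ dist (perturb a g σ Φ) X
  dist-perturb clears Φ X σ-closer = ≤-antisym
    (dist-≤-dist Ψ Φ X λ F ΨF ΦF → let G , ΦG , _ , closer = replace F (≡true⇒≢≡false ΨF ΦF ∘ sym)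
                                    in G , ΦG , closer)
    (dist-≤-dist Φ Ψ X λ F ΦF ΨF → let G , _ , ΨG , closer = replace F (≡true⇒≢≡false ΦF ΨF)
                                    in G , ΨG , closer)
    where
    Ψ = perturb a g σ Φ
    replace : ∀ F → Φ F ≢ Ψ F → Σ[ G ∈ Subset n ] Φ G ≡ true × Ψ G ≡ true × ∣ G Δ X ∣ ≤ ∣ F Δ X ∣
    replace F changed with perturb-changed Φ F changed
    ... | a∈F , gF , ΦσF = σ F , ΦσF , trans (perturb-∉ Φ (clears F)) ΦσF , σ-closer F a∈F gF

perturb-comm : ∀ {n} {a : Fin n} {g h σ τ} → Clears a σ → Clears a τ → ∀ Φ Y →
  perturb a g σ (perturb a h τ Φ) Y ≡ perturb a h τ (perturb a g σ Φ) Y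
perturb-comm {a = a} {g} {h} {σ} {τ} σ-clears τ-clears Φ Y = begin
  (Φ Y xor t) xor (lookup Y a ∧ g Y ∧ perturb a h τ Φ (σ Y))
    ≡⟨ cong (λ z → (Φ Y xor t) xor (lookup Y a ∧ g Y ∧ z)) (perturb-∉ {g = h} {τ} Φ (σ-clears Y)) ⟩
  (Φ Y xor t) xor s
    ≡⟨ xor-swapʳ (Φ Y) t s ⟩
  (Φ Y xor s) xor t
    ≡⟨ cong (λ z → (Φ Y xor s) xor (lookup Y a ∧ h Y ∧ z)) (perturb-∉ {g = g} {σ} Φ (τ-clears Y)) ⟨
  (Φ Y xor s) xor (lookup Y a ∧ h Y ∧ perturb a g σ Φ (τ Y)) ∎
  where
  s = lookup Y a ∧ g Y ∧ Φ (σ Y)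
  t = lookup Y a ∧ h Y ∧ Φ (τ Y)

slide-closer : ∀ fa fb xa xb → fa ≡ true → not fb ≡ true → xa ∧ not xb ≡ false →
  bit (false xor xa) + bit (true xor xb) ≤ bit (fa xor xa) + bit (fb xor xb)
slide-closer true false false false refl refl _  = ≤-refl
slide-closer true false false true  refl refl _  = z≤n
slide-closer true false true  true  refl refl _  = ≤-refl
slide-closer true false true  false refl refl ()
slide-closer _    true  _     _     _    ()   _

exchange-closer : ∀ fa fb xa xb → fa ≡ true → fb ≡ true → xa ∧ not xb ≡ true →
  bit (false xor xa) + bit (false xor xb) ≤ bit (fa xor xa) + bit (fb xor xb)
exchange-closer true true true  false refl refl refl = ≤-refl
exchange-closer true true true  true  refl refl ()
exchange-closer true true false _     refl refl ()

move : ∀ {n} → Fin n → Fin n → Bool → Bool → Subset n → Subset n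
move a b u v Y = (Y [ a ]≔ u) [ b ]≔ v

module _ {n} {a b : Fin n} (a≢b : a ≢ b) where

  lookup-move-a : ∀ u v Y → lookup (move a b u v Y) a ≡ u
  lookup-move-a u v Y = trans (lookup∘update′ a≢b (Y [ a ]≔ u) v) (lookup∘update a Y u)

  ∣move-Δ∣ : ∀ u v F X →
    ∣ move a b u v F Δ X ∣ + (bit (lookup F a xor lookup X a) + bit (lookup F b xor lookup X b))
      ≡ ∣ F Δ X ∣ + (bit (u xor lookup X a) + bit (v xor lookup X b))
  ∣move-Δ∣ u v F X = begin
    ∣ (G [ b ]≔ v) Δ X ∣ + (mis (lookup F a) a + mis (lookup F b) b)
      ≡⟨ x∙yz≈xz∙y ∣ (G [ b ]≔ v) Δ X ∣ _ _ ⟩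
    ∣ (G [ b ]≔ v) Δ X ∣ + mis (lookup F b) b + mis (lookup F a) a
      ≡⟨ cong (λ c → ∣ (G [ b ]≔ v) Δ X ∣ + mis c b + mis (lookup F a) a) Gb≡Fb ⟨
    ∣ (G [ b ]≔ v) Δ X ∣ + mis (lookup G b) b + mis (lookup F a) a
      ≡⟨ cong (_+ mis (lookup F a) a) (∣[i]≔v-Δ∣ G X b v) ⟩
    ∣ G Δ X ∣ + mis v b + mis (lookup F a) a
      ≡⟨ xy∙z≈xz∙y ∣ G Δ X ∣ _ _ ⟩
    ∣ G Δ X ∣ + mis (lookup F a) a + mis v b
      ≡⟨ cong (_+ mis v b) (∣[i]≔v-Δ∣ F X a u) ⟩
    ∣ F Δ X ∣ + mis u a + mis v b
      ≡⟨ +-assoc ∣ F Δ X ∣ _ _ ⟩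
    ∣ F Δ X ∣ + (mis u a + mis v b) ∎
    where
    G = F [ a ]≔ u
    mis : Bool → Fin n → ℕ
    mis c i = bit (c xor lookup X i)
    Gb≡Fb : lookup G b ≡ lookup F b
    Gb≡Fb = lookup∘update′ (a≢b ∘ sym) F u

  ∣move-Δ∣-≤ : ∀ u v F X →
    bit (u xor lookup X a) + bit (v xor lookup X b)
      ≤ bit (lookup F a xor lookup X a) + bit (lookup F b xor lookup X b) →
    ∣ move a b u v F Δ X ∣ ≤ ∣ F Δ X ∣
  ∣move-Δ∣-≤ u v F X le =
    +-cancelʳ-≤ _ _ _ (≤-trans (≤-reflexive (∣move-Δ∣ u v F X)) (+-monoʳ-≤ ∣ F Δ X ∣ le))

  move-clears : ∀ v → Clears a (move a b false v)
  move-clears = lookup-move-a false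

  dist-handleSlide : ∀ Φ X → lookup X a ∧ not (lookup X b) ≡ false →
    dist Φ X ≡ dist (handleSlide Φ a b) X
  dist-handleSlide Φ X a∉X⊎b∈X = dist-perturb (move-clears true) Φ X λ F a∈F b∉F →
    ∣move-Δ∣-≤ false true F X (slide-closer _ _ _ _ a∈F b∉F a∉X⊎b∈X)

  dist-exchange : ∀ Φ X → lookup X a ∧ not (lookup X b) ≡ true →
    dist Φ X ≡ dist (exchange Φ a b) X
  dist-exchange Φ X a∈X∌b = dist-perturb (move-clears false) Φ X λ F a∈F b∈F →
    ∣move-Δ∣-≤ false false F X (exchange-closer _ _ _ _ a∈F b∈F a∈X∌b)

  handleSlide-exchange : ∀ Φ Y → handleSlide (exchange Φ a b) a b Y ≡ exchange (handleSlide Φ a b) a b Y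
  handleSlide-exchange = perturb-comm (move-clears true) (move-clears false)

  dist-pairing : ∀ Φ X → let Φ̃ = handleSlide Φ a b; Φ′ = exchange Φ a b; Φ̃′ = handleSlide Φ′ a b in
    (dist Φ X ≡ dist Φ̃ X × dist Φ′ X ≡ dist Φ̃′ X) ⊎ (dist Φ X ≡ dist Φ′ X × dist Φ̃ X ≡ dist Φ̃′ X)
  dist-pairing Φ X with lookup X a ∧ not (lookup X b) in eq
  ... | false = inj₁ (dist-handleSlide Φ X eq , dist-handleSlide (exchange Φ a b) X eq)
  ... | true  = inj₂ (dist-exchange Φ X eq ,
    trans (dist-exchange (handleSlide Φ a b) X eq) (dist-cong (sym ∘ handleSlide-exchange Φ) X))

count : ∀ {A : Set} → (A → Bool) → List A → ℕ
count p xs = length (filter (λ x → T? (p x)) xs)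

count-∷ : ∀ {A : Set} (p : A → Bool) x xs → count p (x ∷ xs) ≡ bit (p x) + count p xs
count-∷ p x xs with p x
... | true  = refl
... | false = refl

count-balance : ∀ {A : Set} (p q r s : A → Bool) →
  (∀ x → bit (p x) + bit (q x) ≡ bit (r x) + bit (s x)) →
  ∀ xs → count p xs + count q xs ≡ count r xs + count s xs
count-balance p q r s balanced []       = refl
count-balance p q r s balanced (x ∷ xs) = begin
  count p (x ∷ xs) + count q (x ∷ xs)
    ≡⟨ cong₂ _+_ (count-∷ p x xs) (count-∷ q x xs) ⟩
  (bit (p x) + count p xs) + (bit (q x) + count q xs)
    ≡⟨ interchange (bit (p x)) _ _ _ ⟩
  (bit (p x) + bit (q x)) + (count p xs + count q xs)
    ≡⟨ cong₂ _+_ (balanced x) (count-balance p q r s balanced xs) ⟩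
  (bit (r x) + bit (s x)) + (count r xs + count s xs)
    ≡⟨ interchange (bit (r x)) _ _ _ ⟩
  (bit (r x) + count r xs) + (bit (s x) + count s xs)
    ≡⟨ cong₂ _+_ (count-∷ r x xs) (count-∷ s x xs) ⟨
  count r (x ∷ xs) + count s (x ∷ xs) ∎

+m-+n≡+o-+p : ∀ m n o p → m + p ≡ o + n → + m - + n ≡ + o - + p
+m-+n≡+o-+p m n o p m+p≡o+n = begin
  + m - + n           ≡⟨ [+m]-[+n]≡m⊖n m n ⟩
  m ⊖ n               ≡⟨ +-cancelˡ-⊖ p m n ⟨
  (p + m) ⊖ (p + n)   ≡⟨ cong₂ _⊖_ (trans (+-comm p m) (trans m+p≡o+n (+-comm o n))) (+-comm p n) ⟩
  (n + o) ⊖ (n + p)   ≡⟨ +-cancelˡ-⊖ n o p ⟩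
  o ⊖ p               ≡⟨ [+m]-[+n]≡m⊖n o p ⟨
  + o - + p ∎

theorem4 : (n : ℕ) (Φ : SetSystem n) → IsBinary Φ → (a b : Fin n) → a ≢ b →
    ∀ k → qCoeff Φ k - qCoeff (exchange Φ a b) k
          ≡ qCoeff (handleSlide Φ a b) k - qCoeff (handleSlide (exchange Φ a b) a b) k
theorem4 n Φ _ a b a≢b k =
  +m-+n≡+o-+p _ (count (at Φ′) L) _ (count (at Φ̃′) L)
    (count-balance (at Φ) (at Φ̃′) (at Φ̃) (at Φ′) balanced L)
  where
  L = allSubsets n
  Φ′ = exchange Φ a b
  Φ̃ = handleSlide Φ a b
  Φ̃′ = handleSlide Φ′ a b
  at : SetSystem n → Subset n → Bool
  at Ψ X = dist Ψ X ≡ᵇ k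
  bit-at : ∀ {d e} → d ≡ e → bit (d ≡ᵇ k) ≡ bit (e ≡ᵇ k)
  bit-at = cong (bit ∘ (_≡ᵇ k))
  balanced : ∀ X → bit (at Φ X) + bit (at Φ̃′ X) ≡ bit (at Φ̃ X) + bit (at Φ′ X)
  balanced X with dist-pairing a≢b Φ X
  ... | inj₁ (Φ≈Φ̃ , Φ′≈Φ̃′) = cong₂ _+_ (bit-at Φ≈Φ̃) (bit-at (sym Φ′≈Φ̃′))
  ... | inj₂ (Φ≈Φ′ , Φ̃≈Φ̃′) = trans (cong₂ _+_ (bit-at Φ≈Φ′) (bit-at (sym Φ̃≈Φ̃′)))
                                    (+-comm (bit (at Φ′ X)) (bit (at Φ̃ X)))
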